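{- Let $p\ge1$, let $G$ be a graph, let $r=\alpha(G)$, let $\Delta=\Delta(G)$, and let $H=\overline G$. The following are equivalent: (a) $G$ is $\alpha$-critical and $G\in\mathbf W_p$; (b) $\Delta$ is pure, every ridge of $\Delta$ has degree at least $p$, and every missing edge of $\Delta$ is contained in the vertex set of the link of some ridge; (c) $G$ is well-covered, $|F_G(S)|\ge p$ for every $S\in\Omega^*(G)$ with $|S|=r-1$, and $E(G)=\bigcup_{S\in\Omega^*(G),\,|S|=r-1}\binom{F_G(S)}{2}$; (d) $H$ is $K_{r+1}$-saturated, every maximal clique of $H$ has size $r$, and $\delta^{\mathrm{cl}}_{r-1}(H)\ge p$.
   Context: All graphs are finite, simple and non-empty. $\Omega^*(G)$ is the family of independent sets, $\alpha(G)$ the independence number, $\Omega(G)$ the maximum independent sets. $G$ is well-covered if all maximal independent sets have size $\alpha(G)$. $G\in\mathbf W_p$ means: $|V(G)|\ge p$ and any $p$ pairwise disjoint independent sets $A_1,\dots,A_p$ extend to pairwise disjoint maximum independent sets $M_i\supseteq A_i$. An edge $e$ is $\alpha$-critical if $\alpha(G-e)>\alpha(G)$; $G$ is $\alpha$-critical if all edges are. $\Delta(G)$ is the simplicial complex of independent sets of $G$; it is pure if all inclusion-maximal faces have the same size. If pure with facets of size $r$, a ridge is a face of size $r-1$; the link of a face $S$ is $\{T\in\Delta: T\cap S=\emptyset,\ S\cup T\in\Delta\}$, and the degree of a ridge is the number of vertices of its link. A missing edge of $\Delta$ is a 2-element non-face all of whose proper subsets are faces (for $\Delta(G)$ these are exactly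 edges of $G$). For independent $S$ with $|S|=r-1$, $F_G(S)=\{x\in V(G)\setminus S:S\cup\{x\}\in\Omega(G)\}$, and $\binom{F}{2}$ is the set of 2-subsets of $F$. A graph $H$ is $K_t$-saturated if it contains no $K_t$ and adding any non-edge creates a $K_t$. $\mathcal K_t(H)$ is the family of $t$-cliques; for $Q\in\mathcal K_{r-1}(H)$, $\operatorname{codeg}_H(Q)=|\{x\in V(H)\setminus Q:Q\cup\{x\}\in\mathcal K_r(H)\}|$ and $\delta^{\mathrm{cl}}_{r-1}(H)$ is the minimum of these over $\mathcal K_{r-1}(H)$, with conventions $\mathcal K_0(H)=\{\emptyset\}$, $\delta^{\mathrm{cl}}_0(H)=|V(H)|$. -}

module Defs where

open import Data.Nat using (ℕ; suc; _≤_; _<_)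
open import Data.Bool using (Bool; true; false; _∧_; _∨_; not)
open import Data.Fin using (Fin; _≟_)
open import Data.Fin.Subset using (Subset; _∈_; _∉_; _⊆_; ⁅_⁆; _∪_; ∣_∣; ⊥)
open import Data.Product using (Σ; ∃; _×_)
open import Relation.Binary.PropositionalEquality using (_≡_; _≢_)
open import Relation.Nullary using (¬_)
open import Relation.Nullary.Decidable using (⌊_⌋)
open import Function.Bundles using (_⇔_)

record Graph : Set where
  field
    n          : ℕ
    nonempty   : 1 ≤ n
    adj        : Fin n → Fin n → Bool
    adj-sym    : ∀ x y → adj x y ≡ adj y x
    adj-irrefl : ∀ x → adj x x ≡ false

open Graph public

Adj : ℕ → Set
Adj n = Fin n → Fin n → Bool

samePair : ∀ {n} → Fin n → Fin n → Fin n → Fin n → Bool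
samePair x y u v = (⌊ u ≟ x ⌋ ∧ ⌊ v ≟ y ⌋) ∨ (⌊ u ≟ y ⌋ ∧ ⌊ v ≟ x ⌋)

deleteEdge : ∀ {n} → Adj n → Fin n → Fin n → Adj n
deleteEdge A x y u v = A u v ∧ not (samePair x y u v)

addEdge : ∀ {n} → Adj n → Fin n → Fin n → Adj n
addEdge A x y u v = A u v ∨ samePair x y u v

complementAdj : ∀ {n} → Adj n → Adj n
complementAdj A u v = not (A u v) ∧ not ⌊ u ≟ v ⌋

IndepR : ∀ {n} → Adj n → Subset n → Set
IndepR A S = ∀ x y → x ∈ S → y ∈ S → A x y ≡ false

Independent : (G : Graph) → Subset (n G) → Set
Independent G = IndepR (adj G)

IsAlpha : (G : Graph) → ℕ → Set
IsAlpha G r = Σ (Subset (n G)) (λ S → Independent G S × ∣ S ∣ ≡ r)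
            × (∀ S → Independent G S → ∣ S ∣ ≤ r)

Maximum : (G : Graph) → Subset (n G) → Set
Maximum G S = Independent G S × (∀ T → Independent G T → ∣ T ∣ ≤ ∣ S ∣)

MaximalIndep : (G : Graph) → Subset (n G) → Set
MaximalIndep G S = Independent G S × (∀ T → Independent G T → S ⊆ T → T ≡ S)

WellCovered : Graph → Set
WellCovered G = ∀ S → MaximalIndep G S → Maximum G S

AlphaCriticalEdge : (G : Graph) → Fin (n G) → Fin (n G) → Set
AlphaCriticalEdge G x y =
  Σ (Subset (n G)) (λ T → IndepR (deleteEdge (adj G) x y) T
                          × (∀ S → Independent G S → ∣ S ∣ < ∣ T ∣))

AlphaCritical : Graph → Set
AlphaCritical G = ∀ x y → adj G x y ≡ true → AlphaCriticalEdge G x y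

PairwiseDisjoint : ∀ {n p} → (Fin p → Subset n) → Set
PairwiseDisjoint A = ∀ i j → i ≢ j → ∀ x → x ∈ A i → x ∉ A j

W : ℕ → Graph → Set
W p G = p ≤ n G
      × ((A : Fin p → Subset (n G)) → (∀ i → Independent G (A i)) → PairwiseDisjoint A →
         Σ (Fin p → Subset (n G)) (λ M → (∀ i → Maximum G (M i))
                                        × (∀ i → A i ⊆ M i) × PairwiseDisjoint M))

Complex : ℕ → Set₁
Complex n = Subset n → Set

IndComplex : (G : Graph) → Complex (n G)
IndComplex G = Independent G

IsFacet : ∀ {n} → Complex n → Subset n → Set
IsFacet Δ F = Δ F × (∀ T → Δ T → F ⊆ T → T ≡ F)

Pure : ∀ {n} → Complex n → Set
Pure Δ = ∀ F F' → IsFacet Δ F → IsFacet Δ F' → ∣ F ∣ ≡ ∣ F' ∣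

IsRidge : ∀ {n} → Complex n → Subset n → Set
IsRidge Δ S = Δ S × Σ _ (λ F → IsFacet Δ F × suc ∣ S ∣ ≡ ∣ F ∣)

LinkVertex : ∀ {n} → Complex n → Subset n → Fin n → Set
LinkVertex Δ S v = Δ ⁅ v ⁆ × v ∉ S × Δ (⁅ v ⁆ ∪ S)

-- the number of vertices of lk(S) is at least p
-- (L is the vertex set of the link; its cardinality is the degree)
DegreeAtLeast : ∀ {n} → Complex n → Subset n → ℕ → Set
DegreeAtLeast Δ S p = Σ _ (λ L → (∀ v → (v ∈ L) ⇔ LinkVertex Δ S v) × p ≤ ∣ L ∣)

MissingEdge : ∀ {n} → Complex n → Fin n → Fin n → Set
MissingEdge Δ x y = x ≢ y × ¬ Δ (⁅ x ⁆ ∪ ⁅ y ⁆) × Δ ⊥ × Δ ⁅ x ⁆ × Δ ⁅ y ⁆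

InF : (G : Graph) → Subset (n G) → Fin (n G) → Set
InF G S x = x ∉ S × Maximum G (⁅ x ⁆ ∪ S)

FSizeAtLeast : (G : Graph) → Subset (n G) → ℕ → Set
FSizeAtLeast G S p = Σ _ (λ L → (∀ x → (x ∈ L) ⇔ InF G S x) × p ≤ ∣ L ∣)

Clique : ∀ {n} → Adj n → Subset n → Set
Clique B Q = ∀ x y → x ∈ Q → y ∈ Q → x ≢ y → B x y ≡ true

MaximalClique : ∀ {n} → Adj n → Subset n → Set
MaximalClique B Q = Clique B Q × (∀ T → Clique B T → Q ⊆ T → T ≡ Q)

Saturated : ∀ {n} → Adj n → ℕ → Set
Saturated B t = (∀ Q → Clique B Q → ∣ Q ∣ ≢ t)
              × (∀ x y → x ≢ y → B x y ≡ false →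
                   Σ _ (λ Q → Clique (addEdge B x y) Q × ∣ Q ∣ ≡ t))

CodegAtLeast : ∀ {n} → Adj n → Subset n → ℕ → Set
CodegAtLeast B Q p =
  Σ _ (λ L → (∀ x → (x ∈ L) ⇔ (x ∉ Q × Clique B (⁅ x ⁆ ∪ Q))) × p ≤ ∣ L ∣)

CondA : ℕ → Graph → Set
CondA p G = AlphaCritical G × W p G

CondB : ℕ → Graph → Set
CondB p G = Pure Δ
          × (∀ S → IsRidge Δ S → DegreeAtLeast Δ S p)
          × (∀ x y → MissingEdge Δ x y →
               Σ _ (λ R → IsRidge Δ R × LinkVertex Δ R x × LinkVertex Δ R y))
  where Δ = IndComplex G

CondC : ℕ → Graph → ℕ → Set
CondC p G r = WellCovered G
            × (∀ S → Independent G S → suc ∣ S ∣ ≡ r → FSizeAtLeast G S p)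
            × (∀ x y → (adj G x y ≡ true) ⇔
                 Σ _ (λ S → Independent G S × suc ∣ S ∣ ≡ r
                            × x ≢ y × InF G S x × InF G S y))

CondD : ℕ → Graph → ℕ → Set
CondD p G r = Saturated H (suc r)
            × (∀ Q → MaximalClique H Q → ∣ Q ∣ ≡ r)
            × (∀ Q → Clique H Q → suc ∣ Q ∣ ≡ r → CodegAtLeast H Q p)
  where H = complementAdj (adj G)

-- With α(G) = r, the maximum independent sets are exactly the independent r-sets, so for a
-- ridge S (independent, |S| = r - 1) the set F(S) consists of the vertices extending S, and it
-- is a clique: two non-adjacent members would extend S to an independent (r + 1)-set.  An edge
-- xy is α-critical iff G - xy has an independent (r + 1)-set T; such a T contains x and y, and
-- every ridge S ⊆ T ∖ {x, y} has x, y ∈ F(S); conversely {x, y} ∪ S is such a set.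
--
-- For W_p: a maximal S extended together with p - 1 empty sets shows that G is well-covered, and
-- a ridge S extended together with a cover of F(S) by p - 1 singletons shows |F(S)| ≥ p.
-- Conversely, disjoint independent sets are extended one vertex at a time: grow A_i to a ridge S
-- (G is well-covered); the clique F(S) has at least p vertices and each of the other p - 1 sets
-- meets it at most once, so some vertex of F(S) is free for A_i.
--
-- Conditions (b) and (d) restate (c): the facets of Δ(G) are the maximal independent sets, the
-- link vertices of a ridge S form F(S), the missing edges of Δ(G) are the edges of G, and the
-- cliques of the complement are the independent sets of G.

module Submission where

open import Defs
open import Data.Bool using (true; false; not; _∧_)
open import Data.Bool.Properties
  using (T-≡; ¬-not; ∧-identityʳ; ∧-zeroʳ; ∨-identityʳ; ∨-zeroʳ; not-injective) renaming (_≟_ to _≟ᵇ_)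
open import Data.Fin using (Fin; zero; suc; _≟_; fromℕ<; punchIn; punchOut)
open import Data.Fin.Properties using (any?; all?; punchIn-punchOut)
open import Data.Fin.Subset using (Subset; _∈_; _∉_; _⊆_; ⁅_⁆; _∪_; _∩_; _-_; ∣_∣; ⊥)
open import Data.Fin.Subset.Properties
  using (_∈?_; nonempty?; ∉⊥; ⊥⊆; ∣⊥∣≡0; x∈⁅x⁆; x∈⁅y⁆⇒x≡y; ∣⁅x⁆∣≡1; ∣p∣≤n; ⊆-refl; ⊆-trans; ⊆-antisym;
         p⊆q⇒∣p∣≤∣q∣; p⊂q⇒∣p∣<∣q∣; in⊆in; out⊆; q⊆p∪q; x∈p∪q⁻; x∈p∪q⁺; x∈p∩q⁻; x∈p∩q⁺; ∪-identityˡ;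
         p─q⊆p; p─x─y≡p─y─x; x∈p∧x≢y⇒x∈p-y; x∈p⇒∣p-x∣<∣p∣)
open import Data.List using (List; []; allFin) renaming (_∷_ to _∷ₗ_)
open import Data.List.Membership.Propositional using () renaming (_∈_ to _∈ₗ_)
open import Data.List.Membership.Propositional.Properties using (∈-allFin)
open import Data.List.Relation.Unary.Any using () renaming (here to hereₗ; there to thereₗ)
open import Data.Nat using (ℕ; zero; suc; pred; _+_; _≤_; _<_; s≤s; NonZero; >-nonZero)
open import Data.Nat.Properties
  using (module ≤-Reasoning; _≤?_; ≤-trans; ≤-reflexive; ≤-antisym; ≤-pred; n≤1+n; n≮n; <⇒≢; <⇒≱; ≰⇒>;
         n≤0⇒n≡0; m≤n⇒m<n∨m≡n; m≤m+n; +-suc; pred[n]≤n; pred-mono-≤; suc-pred)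
open import Data.Product using (Σ; ∃; _×_; _,_; proj₁; proj₂)
open import Data.Product.Function.NonDependent.Propositional using (_×-⇔_)
open import Data.Sum using (_⊎_; inj₁; inj₂; [_,_]′)
open import Data.Vec using (_∷_; here; there; tabulate)
open import Data.Vec.Properties using ([]=⇒lookup; lookup⇒[]=; lookup∘tabulate)
import Data.Vec.Functional as Vector
open import Data.Vec.Functional.Properties using (updateAt-updates; updateAt-minimal)
open import Function using (_∘_)
open import Function.Bundles using (_⇔_; mk⇔; Equivalence)
open import Function.Construct.Composition using (_⇔-∘_)
open import Function.Construct.Identity using (⇔-id)
open import Function.Construct.Symmetry using (⇔-sym)
open import Level using (Level)
open import Relation.Binary.PropositionalEquality using (_≡_; _≢_; refl; sym; trans; cong; subst)
open import Relation.Nullary using (¬_; yes; no; contradiction)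
open import Relation.Nullary.Decidable
  using (_×-dec_; _→-dec_; ¬?; decidable-stable; isYes; ⌊_⌋; isYes≗does; dec-true; dec-false;
         toWitness; fromWitness)
open import Relation.Unary using (Pred; Decidable)

private
  variable
    ℓ : Level
    m k : ℕ

∣⁅x⁆∪p∣≡1+∣p∣ : ∀ {x : Fin m} {p} → x ∉ p → ∣ ⁅ x ⁆ ∪ p ∣ ≡ suc ∣ p ∣
∣⁅x⁆∪p∣≡1+∣p∣ {x = zero}  {true ∷ p}  x∉p = contradiction here x∉p
∣⁅x⁆∪p∣≡1+∣p∣ {x = zero}  {false ∷ p} _   = cong (suc ∘ ∣_∣) (∪-identityˡ p)
∣⁅x⁆∪p∣≡1+∣p∣ {x = suc x} {true ∷ p}  x∉p = cong suc (∣⁅x⁆∪p∣≡1+∣p∣ (x∉p ∘ there))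
∣⁅x⁆∪p∣≡1+∣p∣ {x = suc x} {false ∷ p} x∉p = ∣⁅x⁆∪p∣≡1+∣p∣ (x∉p ∘ there)

∃-⊆-of-size : ∀ {m k} (p : Subset m) → k ≤ ∣ p ∣ → ∃ λ q → q ⊆ p × ∣ q ∣ ≡ k
∃-⊆-of-size {m} {k = zero} p _ = ⊥ , ⊥⊆ , ∣⊥∣≡0 m
∃-⊆-of-size {k = suc k} (true ∷ p)  (s≤s k≤∣p∣) with ∃-⊆-of-size p k≤∣p∣
... | q , q⊆p , ∣q∣≡k = true ∷ q , in⊆in q⊆p , cong suc ∣q∣≡k
∃-⊆-of-size {k = suc k} (false ∷ p) k≤∣p∣ with ∃-⊆-of-size p k≤∣p∣
... | q , q⊆p , ∣q∣≡k = false ∷ q , out⊆ q⊆p , ∣q∣≡k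

∣p∣<∣q∣⇒∃-∈q-∉p : ∀ {p q : Subset m} → ∣ p ∣ < ∣ q ∣ → ∃ λ x → x ∈ q × x ∉ p
∣p∣<∣q∣⇒∃-∈q-∉p {p = p} {q} ∣p∣<∣q∣ =
  decidable-stable (any? λ x → x ∈? q ×-dec ¬? (x ∈? p)) λ none →
    <⇒≱ ∣p∣<∣q∣ (p⊆q⇒∣p∣≤∣q∣ λ {x} x∈q → decidable-stable (x ∈? p) λ x∉p → none (x , x∈q , x∉p))

p⊆q∧∣q∣≤∣p∣⇒q≡p : ∀ {p q : Subset m} → p ⊆ q → ∣ q ∣ ≤ ∣ p ∣ → q ≡ p
p⊆q∧∣q∣≤∣p∣⇒q≡p {p = p} {q} p⊆q ∣q∣≤∣p∣ = ⊆-antisym q⊆p p⊆q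
  where
  q⊆p : q ⊆ p
  q⊆p {x} x∈q = decidable-stable (x ∈? p) λ x∉p →
    <⇒≱ (p⊂q⇒∣p∣<∣q∣ (p⊆q , x , x∈q , x∉p)) ∣q∣≤∣p∣

x∉p-x : ∀ (p : Subset m) x → x ∉ p - x
x∉p-x (_ ∷ p) (suc x) (there x∈p-x) = x∉p-x p x x∈p-x

x∈p-y⁻ : ∀ {p : Subset m} {x y} → x ∈ p - y → x ∈ p × x ≢ y
x∈p-y⁻ {p = p} {y = y} x∈p-y = p─q⊆p p ⁅ y ⁆ x∈p-y , λ { refl → x∉p-x p y x∈p-y }

x∈⁅x⁆∪p : ∀ {x : Fin m} {p} → x ∈ ⁅ x ⁆ ∪ p
x∈⁅x⁆∪p {x = x} = x∈p∪q⁺ (inj₁ (x∈⁅x⁆ x))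

p⊆⁅x⁆∪p : ∀ {x : Fin m} {p} → p ⊆ ⁅ x ⁆ ∪ p
p⊆⁅x⁆∪p {x = x} {p} = q⊆p∪q ⁅ x ⁆ p

⁅x⁆∪p⊆q : ∀ {x : Fin m} {p q} → x ∈ q → p ⊆ q → ⁅ x ⁆ ∪ p ⊆ q
⁅x⁆∪p⊆q {x = x} {p} x∈q p⊆q y∈ with x∈p∪q⁻ ⁅ x ⁆ p y∈
... | inj₁ y∈⁅x⁆ = subst (_∈ _) (sym (x∈⁅y⁆⇒x≡y x y∈⁅x⁆)) x∈q
... | inj₂ y∈p   = p⊆q y∈p

y∈⁅x⁆∪p⁻ : ∀ {x y : Fin m} {p} → y ∈ ⁅ x ⁆ ∪ p → y ≡ x ⊎ y ∈ p
y∈⁅x⁆∪p⁻ {x = x} {p = p} y∈ with x∈p∪q⁻ ⁅ x ⁆ p y∈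
... | inj₁ y∈⁅x⁆ = inj₁ (x∈⁅y⁆⇒x≡y x y∈⁅x⁆)
... | inj₂ y∈p   = inj₂ y∈p

∣p∣≤1+∣p-x∣ : ∀ (p : Subset m) x → ∣ p ∣ ≤ suc ∣ p - x ∣
∣p∣≤1+∣p-x∣ p x = ≤-trans (p⊆q⇒∣p∣≤∣q∣ p⊆⁅x⁆∪[p-x])
                          (≤-reflexive (∣⁅x⁆∪p∣≡1+∣p∣ (x∉p-x p x)))
  where
  p⊆⁅x⁆∪[p-x] : p ⊆ ⁅ x ⁆ ∪ (p - x)
  p⊆⁅x⁆∪[p-x] {y} y∈p with y ≟ x
  ... | yes refl = x∈⁅x⁆∪p
  ... | no y≢x   = p⊆⁅x⁆∪p (x∈p∧x≢y⇒x∈p-y y∈p y≢x)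

x∉⁅y⁆∪p : ∀ {x y : Fin m} {p} → x ≢ y → x ∉ p → x ∉ ⁅ y ⁆ ∪ p
x∉⁅y⁆∪p x≢y x∉p x∈ with y∈⁅x⁆∪p⁻ x∈
... | inj₁ x≡y = x≢y x≡y
... | inj₂ x∈p = x∉p x∈p

∣⁅x⁆∪⁅y⁆∪p∣≡2+∣p∣ : ∀ {x y : Fin m} {p} → x ≢ y → x ∉ p → y ∉ p →
                    ∣ ⁅ x ⁆ ∪ (⁅ y ⁆ ∪ p) ∣ ≡ suc (suc ∣ p ∣)
∣⁅x⁆∪⁅y⁆∪p∣≡2+∣p∣ x≢y x∉p y∉p =
  trans (∣⁅x⁆∪p∣≡1+∣p∣ (x∉⁅y⁆∪p x≢y x∉p)) (cong suc (∣⁅x⁆∪p∣≡1+∣p∣ y∉p))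

comprehension : ∀ {P : Pred (Fin m) ℓ} → Decidable P → ∃ λ q → ∀ x → x ∈ q ⇔ P x
comprehension {P = P} P? = tabulate (isYes ∘ P?) , λ x → mk⇔ (to x) (from x)
  where
  to : ∀ x → x ∈ tabulate (isYes ∘ P?) → P x
  to x x∈q =
    toWitness (Equivalence.from T-≡ (trans (sym (lookup∘tabulate (isYes ∘ P?) x)) ([]=⇒lookup x∈q)))
  from : ∀ x → P x → x ∈ tabulate (isYes ∘ P?)
  from x Px =
    lookup⇒[]= x _ (trans (lookup∘tabulate (isYes ∘ P?) x) (Equivalence.to T-≡ (fromWitness Px)))

Subsingleton : Subset m → Set
Subsingleton p = ∀ {x y} → x ∈ p → y ∈ p → x ≡ y

⁅x⁆-subsingleton : ∀ (x : Fin m) → Subsingleton ⁅ x ⁆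
⁅x⁆-subsingleton x y∈⁅x⁆ z∈⁅x⁆ = trans (x∈⁅y⁆⇒x≡y x y∈⁅x⁆) (sym (x∈⁅y⁆⇒x≡y x z∈⁅x⁆))

uncovered-by-subsingletons : ∀ {k} (q : Subset m) (B : Fin k → Subset m) → (∀ j → Subsingleton (B j)) →
                             k < ∣ q ∣ → ∃ λ x → x ∈ q × ∀ j → x ∉ B j
uncovered-by-subsingletons {m} {zero} q B _ 0<∣q∣
  with x , x∈q , _ ← ∣p∣<∣q∣⇒∃-∈q-∉p {p = ⊥} (subst (_< ∣ q ∣) (sym (∣⊥∣≡0 m)) 0<∣q∣)
  = x , x∈q , λ ()
uncovered-by-subsingletons {k = suc k} q B B-sub k<∣q∣ with any? (λ z → z ∈? q ×-dec z ∈? B zero)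
... | yes (z , z∈q , z∈B₀)
  with x , x∈q-z , x∉B ← uncovered-by-subsingletons (q - z) (B ∘ suc) (B-sub ∘ suc)
                           (≤-pred (≤-trans k<∣q∣ (∣p∣≤1+∣p-x∣ q z)))
  = x , proj₁ (x∈p-y⁻ x∈q-z) , λ where
      zero x∈B₀ → proj₂ (x∈p-y⁻ x∈q-z) (B-sub zero x∈B₀ z∈B₀)
      (suc j)   → x∉B j
... | no q∩B₀-empty
  with x , x∈q , x∉B ← uncovered-by-subsingletons q (B ∘ suc) (B-sub ∘ suc) (≤-trans (n≤1+n _) k<∣q∣)
  = x , x∈q , λ where
      zero x∈B₀ → q∩B₀-empty (x , x∈q , x∈B₀)
      (suc j)   → x∉B j

∷-pairwiseDisjoint : ∀ {q : Subset m} {B : Fin k → Subset m} →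
                     (∀ j {x} → x ∈ q → x ∉ B j) → PairwiseDisjoint B → PairwiseDisjoint (q Vector.∷ B)
∷-pairwiseDisjoint q#B B-disj zero    zero    0≢0 = contradiction refl 0≢0
∷-pairwiseDisjoint q#B B-disj zero    (suc j) _   _ x∈q x∈Bj = q#B j x∈q x∈Bj
∷-pairwiseDisjoint q#B B-disj (suc i) zero    _   _ x∈Bi x∈q = q#B i x∈q x∈Bi
∷-pairwiseDisjoint q#B B-disj (suc i) (suc j) i≢j = B-disj i j (i≢j ∘ cong suc)

record SubsingletonPartition (k : ℕ) (q : Subset m) : Set where
  field
    part         : Fin k → Subset m
    subsingleton : ∀ j → Subsingleton (part j)
    part⊆        : ∀ j → part j ⊆ q
    disjoint     : PairwiseDisjoint part
    covers       : ∀ {x} → x ∈ q → ∃ λ j → x ∈ part j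

subsingletonPartition : ∀ {k} (q : Subset m) → ∣ q ∣ ≤ k → SubsingletonPartition k q
subsingletonPartition q ∣q∣≤k with nonempty? q
... | no q-empty = record
  { part         = λ _ → ⊥
  ; subsingleton = λ _ x∈⊥ → contradiction x∈⊥ ∉⊥
  ; part⊆        = λ _ → ⊥⊆
  ; disjoint     = λ _ _ _ _ x∈⊥ → contradiction x∈⊥ ∉⊥
  ; covers       = λ x∈q → contradiction (_ , x∈q) q-empty
  }
subsingletonPartition {k = zero} q ∣q∣≤0 | yes (x , x∈q) =
  contradiction (≤-trans (x∈p⇒∣p-x∣<∣p∣ x∈q) ∣q∣≤0) λ ()
subsingletonPartition {k = suc k} q ∣q∣≤1+k | yes (x , x∈q) = record
  { part         = ⁅ x ⁆ Vector.∷ part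
  ; subsingleton = λ where
      zero    → ⁅x⁆-subsingleton x
      (suc j) → subsingleton j
  ; part⊆        = λ where
      zero    y∈⁅x⁆ → subst (_∈ q) (sym (x∈⁅y⁆⇒x≡y x y∈⁅x⁆)) x∈q
      (suc j) y∈Bj  → proj₁ (x∈p-y⁻ (part⊆ j y∈Bj))
  ; disjoint     = ∷-pairwiseDisjoint (λ j y∈⁅x⁆ y∈Bj → proj₂ (x∈p-y⁻ (part⊆ j y∈Bj)) (x∈⁅y⁆⇒x≡y x y∈⁅x⁆))
                                      disjoint
  ; covers       = λ {y} y∈q → case-≟ y y∈q
  }
  where
  open SubsingletonPartition (subsingletonPartition (q - x) (≤-pred (≤-trans (x∈p⇒∣p-x∣<∣p∣ x∈q) ∣q∣≤1+k)))
  case-≟ : ∀ y → y ∈ q → ∃ λ j → y ∈ (⁅ x ⁆ Vector.∷ part) j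
  case-≟ y y∈q with y ≟ x
  ... | yes refl = zero , x∈⁅x⁆ y
  ... | no y≢x with j , y∈Bj ← covers (x∈p∧x≢y⇒x∈p-y y∈q y≢x) = suc j , y∈Bj

updateAt-elim : ∀ {X : Set} (xs : Vector.Vector X k) i {f : X → X} (P : Fin k → X → Set) →
                P i (f (xs i)) → (∀ j → j ≢ i → P j (xs j)) → ∀ j → P j (Vector.updateAt xs i f j)
updateAt-elim xs i P at-i elsewhere j with j ≟ i
... | yes refl = subst (P i) (sym (updateAt-updates i xs)) at-i
... | no j≢i   = subst (P j) (sym (updateAt-minimal j i xs j≢i)) (elsewhere j j≢i)

insertAt : (Fin k → Subset m) → Fin k → Fin m → Fin k → Subset m
insertAt A i v = Vector.updateAt A i (⁅ v ⁆ ∪_)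

CountAtLeast : (Fin m → Set) → ℕ → Set
CountAtLeast P k = Σ (Subset _) λ L → (∀ x → (x ∈ L) ⇔ P x) × k ≤ ∣ L ∣

CountAtLeast-cong : ∀ {P Q : Fin m → Set} → (∀ x → P x ⇔ Q x) → CountAtLeast P k → CountAtLeast Q k
CountAtLeast-cong P⇔Q (L , L⇔P , k≤∣L∣) = L , (λ x → P⇔Q x ⇔-∘ L⇔P x) , k≤∣L∣

⌊x≟x⌋≡true : ∀ (x : Fin m) → ⌊ x ≟ x ⌋ ≡ true
⌊x≟x⌋≡true x = trans (isYes≗does (x ≟ x)) (dec-true (x ≟ x) refl)

⌊x≟y⌋≡false : ∀ {x y : Fin m} → x ≢ y → ⌊ x ≟ y ⌋ ≡ false
⌊x≟y⌋≡false {x = x} {y} x≢y = trans (isYes≗does (x ≟ y)) (dec-false (x ≟ y) x≢y)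

module _ {x y : Fin m} where

  samePair-xy : samePair x y x y ≡ true
  samePair-xy rewrite ⌊x≟x⌋≡true x | ⌊x≟x⌋≡true y = refl

  samePair-yx : samePair x y y x ≡ true
  samePair-yx rewrite ⌊x≟x⌋≡true x | ⌊x≟x⌋≡true y = ∨-zeroʳ _

  samePair-miss : ∀ {u v} → (u ≢ x × v ≢ x) ⊎ (u ≢ y × v ≢ y) → samePair x y u v ≡ false
  samePair-miss {u} {v} (inj₁ (u≢x , v≢x)) rewrite ⌊x≟y⌋≡false u≢x | ⌊x≟y⌋≡false v≢x = ∧-zeroʳ _
  samePair-miss {u} {v} (inj₂ (u≢y , v≢y)) rewrite ⌊x≟y⌋≡false u≢y | ⌊x≟y⌋≡false v≢y =
    trans (∨-identityʳ _) (∧-zeroʳ _)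

module _ {A : Adj m} where

  IndepR-⊆ : ∀ {S T} → T ⊆ S → IndepR A S → IndepR A T
  IndepR-⊆ T⊆S S-indep u v u∈T v∈T = S-indep u v (T⊆S u∈T) (T⊆S v∈T)

  IndepR-⁅x⁆∪⁅y⁆∪ : ∀ {x y S} → IndepR A (⁅ x ⁆ ∪ S) → IndepR A (⁅ y ⁆ ∪ S) →
                    A x y ≡ false → A y x ≡ false → IndepR A (⁅ x ⁆ ∪ (⁅ y ⁆ ∪ S))
  IndepR-⁅x⁆∪⁅y⁆∪ {x} {y} {S} x∪S-indep y∪S-indep xy yx u v u∈ v∈
    with y∈⁅x⁆∪p⁻ u∈ | y∈⁅x⁆∪p⁻ v∈
  ... | inj₁ refl | inj₁ refl = x∪S-indep u v x∈⁅x⁆∪p x∈⁅x⁆∪p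
  ... | inj₁ refl | inj₂ v∈y∪S with y∈⁅x⁆∪p⁻ v∈y∪S
  ...   | inj₁ refl = xy
  ...   | inj₂ v∈S  = x∪S-indep u v x∈⁅x⁆∪p (p⊆⁅x⁆∪p v∈S)
  IndepR-⁅x⁆∪⁅y⁆∪ {x} {y} {S} x∪S-indep y∪S-indep xy yx u v u∈ v∈
      | inj₂ u∈y∪S | inj₁ refl with y∈⁅x⁆∪p⁻ u∈y∪S
  ...   | inj₁ refl = yx
  ...   | inj₂ u∈S  = x∪S-indep u v (p⊆⁅x⁆∪p u∈S) x∈⁅x⁆∪p
  IndepR-⁅x⁆∪⁅y⁆∪ {x} {y} {S} x∪S-indep y∪S-indep xy yx u v u∈ v∈
      | inj₂ u∈y∪S | inj₂ v∈y∪S = y∪S-indep u v u∈y∪S v∈y∪S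

module _ {A : Adj m} {x y : Fin m} where

  deleteEdge-xy : deleteEdge A x y x y ≡ false
  deleteEdge-xy rewrite samePair-xy {x = x} {y} = ∧-zeroʳ _

  deleteEdge-yx : deleteEdge A x y y x ≡ false
  deleteEdge-yx rewrite samePair-yx {x = x} {y} = ∧-zeroʳ _

  IndepR⇒IndepR-deleteEdge : ∀ {T} → IndepR A T → IndepR (deleteEdge A x y) T
  IndepR⇒IndepR-deleteEdge T-indep u v u∈T v∈T rewrite T-indep u v u∈T v∈T = refl

  IndepR-deleteEdge⇒IndepR : ∀ {T} → IndepR (deleteEdge A x y) T → x ∉ T ⊎ y ∉ T → IndepR A T
  IndepR-deleteEdge⇒IndepR {T} T-indep x∉T⊎y∉T u v u∈T v∈T =
    trans (sym (∧-identityʳ (A u v)))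
          (subst (λ b → A u v ∧ not b ≡ false) (samePair-miss (missing x∉T⊎y∉T)) (T-indep u v u∈T v∈T))
    where
    avoids : ∀ {z} → z ∉ T → u ≢ z × v ≢ z
    avoids z∉T = (λ { refl → z∉T u∈T }) , (λ { refl → z∉T v∈T })
    missing : x ∉ T ⊎ y ∉ T → (u ≢ x × v ≢ x) ⊎ (u ≢ y × v ≢ y)
    missing (inj₁ x∉T) = inj₁ (avoids x∉T)
    missing (inj₂ y∉T) = inj₂ (avoids y∉T)

module _ {A : Adj m} where

  complementAdj-≢ : ∀ {u v} → u ≢ v → complementAdj A u v ≡ not (A u v)
  complementAdj-≢ u≢v rewrite ⌊x≟y⌋≡false u≢v = ∧-identityʳ _

  Clique-complement⇔IndepR : (∀ x → A x x ≡ false) → ∀ {Q} → Clique (complementAdj A) Q ⇔ IndepR A Q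
  Clique-complement⇔IndepR irrefl = mk⇔ to from
    where
    to : ∀ {Q} → Clique (complementAdj A) Q → IndepR A Q
    to Q-clique u v u∈Q v∈Q with u ≟ v
    ... | yes refl = irrefl u
    ... | no u≢v   = not-injective (trans (sym (complementAdj-≢ u≢v)) (Q-clique u v u∈Q v∈Q u≢v))
    from : ∀ {Q} → IndepR A Q → Clique (complementAdj A) Q
    from Q-indep u v u∈Q v∈Q u≢v = trans (complementAdj-≢ u≢v) (cong not (Q-indep u v u∈Q v∈Q))

  addEdge-complementAdj : ∀ {x y u v} → u ≢ v →
                          addEdge (complementAdj A) x y u v ≡ complementAdj (deleteEdge A x y) u v
  addEdge-complementAdj {x} {y} {u} {v} u≢v
    rewrite ⌊x≟y⌋≡false u≢v
    with A u v | samePair x y u v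
  ... | true  | true  = refl
  ... | true  | false = refl
  ... | false | _     = refl

Clique-cong : ∀ {B B′ : Adj m} → (∀ {u v} → u ≢ v → B u v ≡ B′ u v) → ∀ {Q} → Clique B Q → Clique B′ Q
Clique-cong B≗B′ Q-clique u v u∈Q v∈Q u≢v = trans (sym (B≗B′ u≢v)) (Q-clique u v u∈Q v∈Q u≢v)

Clique-addEdge-complement⇔IndepR-deleteEdge :
  ∀ {A : Adj m} {x y} → (∀ u → A u u ≡ false) →
  ∀ {Q} → Clique (addEdge (complementAdj A) x y) Q ⇔ IndepR (deleteEdge A x y) Q
Clique-addEdge-complement⇔IndepR-deleteEdge {A = A} {x} {y} irrefl =
  Clique-complement⇔IndepR (λ u → cong (_∧ _) (irrefl u))
  ⇔-∘ mk⇔ (Clique-cong add≗delete) (Clique-cong (sym ∘ add≗delete))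
  where
  add≗delete : ∀ {u v} → u ≢ v → addEdge (complementAdj A) x y u v ≡ complementAdj (deleteEdge A x y) u v
  add≗delete = addEdge-complementAdj {A = A}

module _ (G : Graph) where

  private
    V : Set
    V = Fin (n G)

    H : Adj (n G)
    H = complementAdj (adj G)

  adj⇒≢ : ∀ {x y} → adj G x y ≡ true → x ≢ y
  adj⇒≢ {x} xy≡true refl = contradiction (trans (sym xy≡true) (adj-irrefl G x)) λ ()

  Independent-⊥ : Independent G ⊥
  Independent-⊥ _ _ x∈⊥ = contradiction x∈⊥ ∉⊥

  Subsingleton⇒Independent : ∀ {S} → Subsingleton S → Independent G S
  Subsingleton⇒Independent S-sub u v u∈S v∈S rewrite S-sub u∈S v∈S = adj-irrefl G v

  Independent-⁅⁆ : ∀ x → Independent G ⁅ x ⁆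
  Independent-⁅⁆ x = Subsingleton⇒Independent (⁅x⁆-subsingleton x)

  Independent-⁅x⁆∪ : ∀ {x S} → Independent G S → (∀ s → s ∈ S → adj G x s ≡ false) →
                     Independent G (⁅ x ⁆ ∪ S)
  Independent-⁅x⁆∪ S-indep x-nonadj u v u∈ v∈ with y∈⁅x⁆∪p⁻ u∈ | y∈⁅x⁆∪p⁻ v∈
  ... | inj₁ refl | inj₁ refl = adj-irrefl G u
  ... | inj₁ refl | inj₂ v∈S  = x-nonadj v v∈S
  ... | inj₂ u∈S  | inj₁ refl = trans (adj-sym G u v) (x-nonadj u u∈S)
  ... | inj₂ u∈S  | inj₂ v∈S  = S-indep u v u∈S v∈S

  independent? : Decidable (Independent G)
  independent? S = all? λ u → all? λ v → u ∈? S →-dec (v ∈? S →-dec (adj G u v ≟ᵇ false))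

  extend-or-maximal : ∀ {S} → Independent G S →
                      (∃ λ x → x ∉ S × Independent G (⁅ x ⁆ ∪ S)) ⊎ MaximalIndep G S
  extend-or-maximal {S} S-indep with any? (λ x → ¬? (x ∈? S) ×-dec independent? (⁅ x ⁆ ∪ S))
  ... | yes extension = inj₁ extension
  ... | no  none      = inj₂ (S-indep , λ T T-indep S⊆T → ⊆-antisym (T⊆S T-indep S⊆T) S⊆T)
    where
    T⊆S : ∀ {T} → Independent G T → S ⊆ T → T ⊆ S
    T⊆S T-indep S⊆T {y} y∈T = decidable-stable (y ∈? S) λ y∉S →
      none (y , y∉S , IndepR-⊆ (⁅x⁆∪p⊆q y∈T S⊆T) T-indep)

  MissingEdge⇔adj : ∀ {x y} → MissingEdge (IndComplex G) x y ⇔ adj G x y ≡ true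
  MissingEdge⇔adj {x} {y} = mk⇔ to from
    where
    to : MissingEdge (IndComplex G) x y → adj G x y ≡ true
    to (_ , ¬xy-indep , _) = decidable-stable (adj G x y ≟ᵇ true) λ xy≢true →
      ¬xy-indep (Independent-⁅x⁆∪ (Independent-⁅⁆ y) λ s s∈⁅y⁆ →
        subst (λ z → adj G x z ≡ false) (sym (x∈⁅y⁆⇒x≡y y s∈⁅y⁆)) (¬-not xy≢true))
    from : adj G x y ≡ true → MissingEdge (IndComplex G) x y
    from xy≡true = adj⇒≢ xy≡true
                 , (λ xy-indep → contradiction (trans (sym xy≡true) (xy-indep x y x∈⁅x⁆∪p (p⊆⁅x⁆∪p (x∈⁅x⁆ y))))
                                              λ ())
                 , Independent-⊥ , Independent-⁅⁆ x , Independent-⁅⁆ y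

  complementAdj≡false⇔adj : ∀ {x y} → x ≢ y → H x y ≡ false ⇔ adj G x y ≡ true
  complementAdj≡false⇔adj x≢y = mk⇔
    (λ co≡false → not-injective (trans (sym (complementAdj-≢ {A = adj G} x≢y)) co≡false))
    (λ xy≡true → trans (complementAdj-≢ {A = adj G} x≢y) (cong not xy≡true))

  Clique⇔Independent : ∀ {Q} → Clique (H) Q ⇔ Independent G Q
  Clique⇔Independent = Clique-complement⇔IndepR (adj-irrefl G)

  MaximalClique⇔MaximalIndep : ∀ {Q} → MaximalClique (H) Q ⇔ MaximalIndep G Q
  MaximalClique⇔MaximalIndep = mk⇔
    (λ (Q-clique , Q-max) → clique⇒indep Q-clique , λ T T-indep → Q-max T (indep⇒clique T-indep))
    (λ (Q-indep , Q-max) → indep⇒clique Q-indep , λ T T-clique → Q-max T (clique⇒indep T-clique))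
    where
    clique⇒indep : ∀ {Q} → Clique (H) Q → Independent G Q
    clique⇒indep = Equivalence.to Clique⇔Independent
    indep⇒clique : ∀ {Q} → Independent G Q → Clique (H) Q
    indep⇒clique = Equivalence.from Clique⇔Independent

  DisjointIndependent : (Fin k → Subset (n G)) → Set
  DisjointIndependent A = (∀ i → Independent G (A i)) × PairwiseDisjoint A

  record Extension (A : Fin k → Subset (n G)) (done : Fin k → Set) : Set where
    field
      family   : Fin k → Subset (n G)
      packing  : DisjointIndependent family
      extends  : ∀ i → A i ⊆ family i
      complete : ∀ i → done i → Maximum G (family i)

  module _ {A : Fin k → Subset (n G)} {i : Fin k} {v : V} where

    ⊆-insertAt : ∀ j → A j ⊆ insertAt A i v j
    ⊆-insertAt = updateAt-elim A i {⁅ v ⁆ ∪_} (λ j T → A j ⊆ T) p⊆⁅x⁆∪p (λ _ _ → ⊆-refl)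

    insertAt-DisjointIndependent : DisjointIndependent A → Independent G (⁅ v ⁆ ∪ A i) →
                                   (∀ j → j ≢ i → v ∉ A j) →
                                   DisjointIndependent (insertAt A i v)
    insertAt-DisjointIndependent (A-indep , A-disj) v∪Aᵢ-indep v-fresh =
      updateAt-elim A i {⁅ v ⁆ ∪_} (λ _ → Independent G) v∪Aᵢ-indep (λ j _ → A-indep j) , disjoint
      where
      ∈-insertAt⁻ : ∀ j {x} → x ∈ insertAt A i v j → x ∈ A j ⊎ (x ≡ v × j ≡ i)
      ∈-insertAt⁻ = updateAt-elim A i {⁅ v ⁆ ∪_} (λ j T → ∀ {x} → x ∈ T → x ∈ A j ⊎ (x ≡ v × j ≡ i))
        (λ x∈ → [ (λ x≡v → inj₂ (x≡v , refl)) , inj₁ ]′ (y∈⁅x⁆∪p⁻ x∈))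
        (λ _ _ → inj₁)
      disjoint : PairwiseDisjoint (insertAt A i v)
      disjoint j₁ j₂ j₁≢j₂ x x∈₁ x∈₂ with ∈-insertAt⁻ j₁ x∈₁ | ∈-insertAt⁻ j₂ x∈₂
      ... | inj₁ x∈A₁          | inj₁ x∈A₂          = A-disj j₁ j₂ j₁≢j₂ x x∈A₁ x∈A₂
      ... | inj₁ x∈A₁          | inj₂ (refl , refl) = v-fresh j₁ j₁≢j₂ x∈A₁
      ... | inj₂ (refl , refl) | inj₁ x∈A₂          = v-fresh j₂ (j₁≢j₂ ∘ sym) x∈A₂
      ... | inj₂ (refl , refl) | inj₂ (_ , refl)    = j₁≢j₂ refl

  module _ {r : ℕ} (α : IsAlpha G r) where

    private
      S₀ : Subset (n G)
      S₀ = proj₁ (proj₁ α)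

      S₀-indep : Independent G S₀
      S₀-indep = proj₁ (proj₂ (proj₁ α))

      ∣S₀∣≡r : ∣ S₀ ∣ ≡ r
      ∣S₀∣≡r = proj₂ (proj₂ (proj₁ α))

      ∣indep∣≤r : ∀ {S} → Independent G S → ∣ S ∣ ≤ r
      ∣indep∣≤r = proj₂ α _

      1≤r : 1 ≤ r
      1≤r = subst (_≤ r) (∣⁅x⁆∣≡1 x₀) (∣indep∣≤r (Independent-⁅⁆ x₀))
        where x₀ = fromℕ< (nonempty G)

      -- G is non-empty, so r ≥ 1 and the ridge size pred r is not truncated.
      instance
        r-nonZero : NonZero r
        r-nonZero = >-nonZero 1≤r

    Maximum⇒∣∣≡r : ∀ {S} → Maximum G S → ∣ S ∣ ≡ r
    Maximum⇒∣∣≡r (S-indep , S-max) =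
      ≤-antisym (∣indep∣≤r S-indep) (subst (_≤ _) ∣S₀∣≡r (S-max S₀ S₀-indep))

    ∣∣≡r⇒Maximum : ∀ {S} → Independent G S → ∣ S ∣ ≡ r → Maximum G S
    ∣∣≡r⇒Maximum S-indep ∣S∣≡r = S-indep , λ T T-indep → subst (_ ≤_) (sym ∣S∣≡r) (∣indep∣≤r T-indep)

    Maximum⇒MaximalIndep : ∀ {S} → Maximum G S → MaximalIndep G S
    Maximum⇒MaximalIndep (S-indep , S-max) =
      S-indep , λ T T-indep S⊆T → p⊆q∧∣q∣≤∣p∣⇒q≡p S⊆T (S-max T T-indep)

    Maximum-⊆ : ∀ {S T} → Maximum G S → S ⊆ T → Independent G T → Maximum G T
    Maximum-⊆ (_ , S-max) S⊆T T-indep = T-indep , λ U U-indep → ≤-trans (S-max U U-indep) (p⊆q⇒∣p∣≤∣q∣ S⊆T)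

    ∃-MaximalIndep : ∃ λ S → MaximalIndep G S × ∣ S ∣ ≡ r
    ∃-MaximalIndep = S₀ , Maximum⇒MaximalIndep (∣∣≡r⇒Maximum S₀-indep ∣S₀∣≡r) , ∣S₀∣≡r

    ridge-⊆ : ∀ (P : Subset (n G)) → r ≤ suc ∣ P ∣ → ∃ λ S → S ⊆ P × suc ∣ S ∣ ≡ r
    ridge-⊆ P r≤1+∣P∣ with S , S⊆P , ∣S∣≡r-1 ← ∃-⊆-of-size P (pred-mono-≤ r≤1+∣P∣) =
      S , S⊆P , trans (cong suc ∣S∣≡r-1) (suc-pred r)

    ∃-ridge : ∃ λ S → Independent G S × suc ∣ S ∣ ≡ r
    ∃-ridge with S , S⊆S₀ , ∣S∣+1≡r ← ridge-⊆ S₀ (subst (_≤ suc ∣ S₀ ∣) ∣S₀∣≡r (n≤1+n ∣ S₀ ∣)) =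
      S , IndepR-⊆ S⊆S₀ S₀-indep , ∣S∣+1≡r

    InF⇔ : ∀ {S x} → suc ∣ S ∣ ≡ r → InF G S x ⇔ (x ∉ S × Independent G (⁅ x ⁆ ∪ S))
    InF⇔ ∣S∣+1≡r = mk⇔
      (λ (x∉S , x∪S-max) → x∉S , proj₁ x∪S-max)
      (λ (x∉S , x∪S-indep) → x∉S , ∣∣≡r⇒Maximum x∪S-indep (trans (∣⁅x⁆∪p∣≡1+∣p∣ x∉S) ∣S∣+1≡r))

    F-set : ∀ {S} → suc ∣ S ∣ ≡ r → ∃ λ L → ∀ x → x ∈ L ⇔ InF G S x
    F-set {S} ∣S∣+1≡r with L , L⇔ ← comprehension (λ x → ¬? (x ∈? S) ×-dec independent? (⁅ x ⁆ ∪ S)) =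
      L , λ x → ⇔-sym (InF⇔ ∣S∣+1≡r) ⇔-∘ L⇔ x

    InF-adj : ∀ {S x y} → x ≢ y → InF G S x → InF G S y → adj G x y ≡ true
    InF-adj {S} {x} {y} x≢y (x∉S , x∪S-max) (y∉S , y∪S-max) =
      decidable-stable (adj G x y ≟ᵇ true) λ xy≢true →
        n≮n r (subst (_≤ r) ∣T∣≡1+r (∣indep∣≤r (T-indep (¬-not xy≢true))))
      where
      T-indep : adj G x y ≡ false → Independent G (⁅ x ⁆ ∪ (⁅ y ⁆ ∪ S))
      T-indep xy≡false =
        IndepR-⁅x⁆∪⁅y⁆∪ (proj₁ x∪S-max) (proj₁ y∪S-max) xy≡false (trans (adj-sym G y x) xy≡false)
      ∣T∣≡1+r : ∣ ⁅ x ⁆ ∪ (⁅ y ⁆ ∪ S) ∣ ≡ suc r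
      ∣T∣≡1+r = trans (∣⁅x⁆∪p∣≡1+∣p∣ (x∉⁅y⁆∪p x≢y x∉S)) (cong suc (Maximum⇒∣∣≡r y∪S-max))

    AlphaCriticalEdge⇔ : ∀ {x y} → AlphaCriticalEdge G x y ⇔
                         (∃ λ T → IndepR (deleteEdge (adj G) x y) T × ∣ T ∣ ≡ suc r)
    AlphaCriticalEdge⇔ = mk⇔ to from
      where
      to : ∀ {x y} → AlphaCriticalEdge G x y → ∃ λ T → IndepR (deleteEdge (adj G) x y) T × ∣ T ∣ ≡ suc r
      to (T , T-indep , T-large)
        with U , U⊆T , ∣U∣≡1+r ← ∃-⊆-of-size T (subst (λ s → suc s ≤ ∣ T ∣) ∣S₀∣≡r (T-large S₀ S₀-indep)) =
        U , IndepR-⊆ U⊆T T-indep , ∣U∣≡1+r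
      from : ∀ {x y} → (∃ λ T → IndepR (deleteEdge (adj G) x y) T × ∣ T ∣ ≡ suc r) → AlphaCriticalEdge G x y
      from (T , T-indep , ∣T∣≡1+r) =
        T , T-indep , λ S S-indep → subst (∣ S ∣ <_) (sym ∣T∣≡1+r) (s≤s (∣indep∣≤r S-indep))

    InCommonF : V → V → Set
    InCommonF x y = Σ (Subset (n G)) λ S → Independent G S × suc ∣ S ∣ ≡ r × x ≢ y × InF G S x × InF G S y

    InCommonF⇒adj : ∀ {x y} → InCommonF x y → adj G x y ≡ true
    InCommonF⇒adj (_ , _ , _ , x≢y , x∈F , y∈F) = InF-adj x≢y x∈F y∈F

    InCommonF⇒critical : ∀ {x y} → InCommonF x y → ∃ λ T → IndepR (deleteEdge (adj G) x y) T × ∣ T ∣ ≡ suc r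
    InCommonF⇒critical {x} {y} (S , _ , ∣S∣+1≡r , x≢y , (x∉S , x∪S-max) , (y∉S , y∪S-max)) =
      ⁅ x ⁆ ∪ (⁅ y ⁆ ∪ S) ,
      IndepR-⁅x⁆∪⁅y⁆∪ (IndepR⇒IndepR-deleteEdge (proj₁ x∪S-max)) (IndepR⇒IndepR-deleteEdge (proj₁ y∪S-max))
                      (deleteEdge-xy {A = adj G}) (deleteEdge-yx {A = adj G}) ,
      trans (∣⁅x⁆∪⁅y⁆∪p∣≡2+∣p∣ x≢y x∉S y∉S) (cong suc ∣S∣+1≡r)

    ridge⊆T-x-y⇒InCommonF : ∀ {x y T} → x ≢ y → x ∈ T → y ∈ T →
                              Independent G (T - x) → Independent G (T - y) →
                              (∃ λ S → S ⊆ T - x - y × suc ∣ S ∣ ≡ r) → InCommonF x y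
    ridge⊆T-x-y⇒InCommonF {x} {y} {T} x≢y x∈T y∈T T-x-indep T-y-indep (S , S⊆T-x-y , ∣S∣+1≡r) =
      S , IndepR-⊆ S⊆T-y T-y-indep , ∣S∣+1≡r , x≢y ,
      Equivalence.from (InF⇔ ∣S∣+1≡r)
        (x∉S , IndepR-⊆ (⁅x⁆∪p⊆q (x∈p∧x≢y⇒x∈p-y x∈T x≢y) S⊆T-y) T-y-indep) ,
      Equivalence.from (InF⇔ ∣S∣+1≡r)
        (y∉S , IndepR-⊆ (⁅x⁆∪p⊆q (x∈p∧x≢y⇒x∈p-y y∈T (x≢y ∘ sym)) S⊆T-x) T-x-indep)
      where
      S⊆T-x : S ⊆ T - x
      S⊆T-x = p─q⊆p (T - x) ⁅ y ⁆ ∘ S⊆T-x-y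
      S⊆T-y : S ⊆ T - y
      S⊆T-y = p─q⊆p (T - y) ⁅ x ⁆ ∘ subst (_ ∈_) (p─x─y≡p─y─x T x y) ∘ S⊆T-x-y
      x∉S : x ∉ S
      x∉S = x∉p-x T x ∘ S⊆T-x
      y∉S : y ∉ S
      y∉S = x∉p-x (T - x) y ∘ S⊆T-x-y

    -- T is too large to be independent in G, so it contains both x and y, and dropping either
    -- of them leaves a set independent in G.
    critical⇒InCommonF : ∀ {x y T} → adj G x y ≡ true → IndepR (deleteEdge (adj G) x y) T →
                         ∣ T ∣ ≡ suc r → InCommonF x y
    critical⇒InCommonF {x} {y} {T} xy≡true T-indep ∣T∣≡1+r
      = ridge⊆T-x-y⇒InCommonF (adj⇒≢ xy≡true) (∈T inj₁) (∈T inj₂)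
          (without x inj₁) (without y inj₂) (ridge-⊆ (T - x - y) r≤1+∣T-x-y∣)
      where
      r≤1+∣T-x-y∣ : r ≤ suc ∣ T - x - y ∣
      r≤1+∣T-x-y∣ = ≤-pred (subst (_≤ suc (suc ∣ T - x - y ∣)) ∣T∣≡1+r
                                  (≤-trans (∣p∣≤1+∣p-x∣ T x) (s≤s (∣p∣≤1+∣p-x∣ (T - x) y))))
      dependent : ¬ Independent G T
      dependent T-indepG = n≮n r (subst (_≤ r) ∣T∣≡1+r (∣indep∣≤r T-indepG))
      ∈T : ∀ {z} → (z ∉ T → x ∉ T ⊎ y ∉ T) → z ∈ T
      ∈T {z} missing = decidable-stable (z ∈? T) (dependent ∘ IndepR-deleteEdge⇒IndepR T-indep ∘ missing)
      without : ∀ z → (z ∉ T - z → x ∉ T - z ⊎ y ∉ T - z) → Independent G (T - z)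
      without z missing = IndepR-deleteEdge⇒IndepR (IndepR-⊆ (p─q⊆p T ⁅ z ⁆) T-indep) (missing (x∉p-x T z))

    EdgesInCommonF : Set
    EdgesInCommonF = ∀ x y → adj G x y ≡ true ⇔ InCommonF x y

    AlphaCritical⇔EdgesInCommonF : AlphaCritical G ⇔ EdgesInCommonF
    AlphaCritical⇔EdgesInCommonF = mk⇔
      (λ critical x y → mk⇔
         (λ xy≡true → let T , T-indep , ∣T∣≡1+r = Equivalence.to AlphaCriticalEdge⇔ (critical x y xy≡true)
                      in critical⇒InCommonF xy≡true T-indep ∣T∣≡1+r)
         InCommonF⇒adj)
      (λ edges x y xy≡true →
         Equivalence.from AlphaCriticalEdge⇔ (InCommonF⇒critical (Equivalence.to (edges x y) xy≡true)))

    extend-to-size : WellCovered G → ∀ k {S} → Independent G S → ∣ S ∣ ≤ k → k ≤ r →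
                     ∃ λ S′ → S ⊆ S′ × Independent G S′ × ∣ S′ ∣ ≡ k
    extend-to-size _ zero {S} S-indep ∣S∣≤0 _ = S , ⊆-refl , S-indep , n≤0⇒n≡0 ∣S∣≤0
    extend-to-size well-covered (suc k) {S} S-indep ∣S∣≤1+k 1+k≤r with m≤n⇒m<n∨m≡n ∣S∣≤1+k
    ... | inj₂ ∣S∣≡1+k = S , ⊆-refl , S-indep , ∣S∣≡1+k
    ... | inj₁ (s≤s ∣S∣≤k)
      with S′ , S⊆S′ , S′-indep , ∣S′∣≡k ←
             extend-to-size well-covered k S-indep ∣S∣≤k (≤-trans (n≤1+n k) 1+k≤r)
      with extend-or-maximal S′-indep
    ...   | inj₁ (x , x∉S′ , x∪S′-indep) =
            ⁅ x ⁆ ∪ S′ , p⊆⁅x⁆∪p ∘ S⊆S′ , x∪S′-indep , trans (∣⁅x⁆∪p∣≡1+∣p∣ x∉S′) (cong suc ∣S′∣≡k)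
    ...   | inj₂ S′-maximal =
            contradiction (trans (sym ∣S′∣≡k) (Maximum⇒∣∣≡r (well-covered S′ S′-maximal))) (<⇒≢ 1+k≤r)

    FAtLeast : ℕ → Set
    FAtLeast p = ∀ S → Independent G S → suc ∣ S ∣ ≡ r → FSizeAtLeast G S p

    W⇒WellCovered : ∀ {p} → W (suc p) G → WellCovered G
    W⇒WellCovered (_ , extend) S (S-indep , S-maximal)
      with M , M-max , A⊆M , _ ← extend (S Vector.∷ λ _ → ⊥)
                                        (λ { zero → S-indep ; (suc _) → Independent-⊥ })
                                        (∷-pairwiseDisjoint (λ _ _ → ∉⊥) λ _ _ _ _ x∈⊥ → contradiction x∈⊥ ∉⊥)
      = subst (Maximum G) (S-maximal (M zero) (proj₁ (M-max zero)) (A⊆M zero)) (M-max zero)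

    module _ {p S L} (w : W (suc p) G) (S-indep : Independent G S) (∣S∣+1≡r : suc ∣ S ∣ ≡ r)
             (L⇔F : ∀ x → x ∈ L ⇔ InF G S x) where

      private
        -- The maximum set extending S takes a vertex of F(S), which a singleton already holds.
        F-partition-escapes : ¬ SubsingletonPartition p L
        F-partition-escapes partition =
          let M , M-max , A⊆M , M-disj = proj₂ w (S Vector.∷ part) A-indep A-disj
              x , x∈M₀ , x∉S =
                ∣p∣<∣q∣⇒∃-∈q-∉p (≤-reflexive (trans ∣S∣+1≡r (sym (Maximum⇒∣∣≡r (M-max zero)))))
              x∈F = Equivalence.from (InF⇔ ∣S∣+1≡r)
                      (x∉S , IndepR-⊆ (⁅x⁆∪p⊆q x∈M₀ (A⊆M zero)) (proj₁ (M-max zero)))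
              j , x∈partⱼ = covers (Equivalence.from (L⇔F x) x∈F)
          in M-disj zero (suc j) (λ ()) x x∈M₀ (A⊆M (suc j) x∈partⱼ)
          where
          open SubsingletonPartition partition
          A-indep : ∀ i → Independent G ((S Vector.∷ part) i)
          A-indep zero    = S-indep
          A-indep (suc j) = Subsingleton⇒Independent (subsingleton j)
          A-disj : PairwiseDisjoint (S Vector.∷ part)
          A-disj = ∷-pairwiseDisjoint
            (λ j x∈S x∈partⱼ → proj₁ (Equivalence.to (L⇔F _) (part⊆ j x∈partⱼ)) x∈S) disjoint

      W⇒∣F∣>p : suc p ≤ ∣ L ∣
      W⇒∣F∣>p = decidable-stable (suc p ≤? ∣ L ∣) λ p≮∣L∣ →
        F-partition-escapes (subsingletonPartition L (≤-pred (≰⇒> p≮∣L∣)))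

    W⇒FAtLeast : ∀ {p} → W (suc p) G → FAtLeast (suc p)
    W⇒FAtLeast w S S-indep ∣S∣+1≡r with L , L⇔F ← F-set ∣S∣+1≡r = L , L⇔F , W⇒∣F∣>p w S-indep ∣S∣+1≡r L⇔F

    F∩Independent-subsingleton : ∀ {S L B} → (∀ x → x ∈ L ⇔ InF G S x) → Independent G B →
                                 Subsingleton (L ∩ B)
    F∩Independent-subsingleton {L = L} {B} L⇔F B-indep {x} {y} x∈L∩B y∈L∩B =
      decidable-stable (x ≟ y) λ x≢y →
        let x∈L , x∈B = x∈p∩q⁻ L B x∈L∩B
            y∈L , y∈B = x∈p∩q⁻ L B y∈L∩B
            xy≡true = InF-adj x≢y (Equivalence.to (L⇔F x) x∈L) (Equivalence.to (L⇔F y) y∈L)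
        in contradiction (trans (sym xy≡true) (B-indep x y x∈B y∈B)) λ ()

    F-avoids : ∀ {p S L} {A : Fin (suc p) → Subset (n G)} (i : Fin (suc p)) → (∀ j → Independent G (A j)) →
               (∀ x → x ∈ L ⇔ InF G S x) → suc p ≤ ∣ L ∣ → ∃ λ v → InF G S v × ∀ j → j ≢ i → v ∉ A j
    F-avoids {L = L} {A} i A-indep L⇔F p<∣L∣ =
      let v , v∈L , v∉L∩A = uncovered-by-subsingletons L (λ j → L ∩ A (punchIn i j))
                              (λ j → F∩Independent-subsingleton L⇔F (A-indep (punchIn i j))) p<∣L∣
      in v , Equivalence.to (L⇔F v) v∈L , λ j j≢i v∈Aⱼ →
           v∉L∩A (punchOut (j≢i ∘ sym))
                 (x∈p∩q⁺ (v∈L , subst (λ k → v ∈ A k) (sym (punchIn-punchOut (j≢i ∘ sym))) v∈Aⱼ))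

    module _ {p} (well-covered : WellCovered G) (F-large : FAtLeast (suc p)) where

      free-vertex : ∀ {A : Fin (suc p) → Subset (n G)} → (∀ j → Independent G (A j)) → ∀ i → ∣ A i ∣ < r →
                    ∃ λ v → v ∉ A i × Independent G (⁅ v ⁆ ∪ A i) × ∀ j → j ≢ i → v ∉ A j
      free-vertex {A} A-indep i ∣Aᵢ∣<r =
        let S , Aᵢ⊆S , S-indep , ∣S∣≡r-1 =
              extend-to-size well-covered (pred r) (A-indep i) (pred-mono-≤ ∣Aᵢ∣<r) pred[n]≤n
            L , L⇔F , p<∣L∣ = F-large S S-indep (trans (cong suc ∣S∣≡r-1) (suc-pred r))
            v , (v∉S , v∪S-max) , v-fresh = F-avoids i A-indep L⇔F p<∣L∣
        in v , v∉S ∘ Aᵢ⊆S , IndepR-⊆ (⁅x⁆∪p⊆q x∈⁅x⁆∪p (p⊆⁅x⁆∪p ∘ Aᵢ⊆S)) (proj₁ v∪S-max) , v-fresh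

      -- d bounds the number of vertices still missing from A i.
      extend-at : ∀ d {A : Fin (suc p) → Subset (n G)} → DisjointIndependent A →
                  ∀ i → r ≤ d + ∣ A i ∣ → Extension A (_≡ i)
      extend-at d {A} A-packing i _ with r ≤? ∣ A i ∣
      ... | yes r≤∣Aᵢ∣ = record
        { family   = A
        ; packing  = A-packing
        ; extends  = λ _ → ⊆-refl
        ; complete = λ { _ refl → ∣∣≡r⇒Maximum Aᵢ-indep (≤-antisym (∣indep∣≤r Aᵢ-indep) r≤∣Aᵢ∣) }
        }
        where
        Aᵢ-indep : Independent G (A i)
        Aᵢ-indep = proj₁ A-packing i
      extend-at zero    A-packing i r≤∣Aᵢ∣ | no r≰∣Aᵢ∣ = contradiction r≤∣Aᵢ∣ r≰∣Aᵢ∣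
      extend-at (suc d) {A} A-packing i r≤1+d+∣Aᵢ∣ | no r≰∣Aᵢ∣ =
        let v , v∉Aᵢ , v∪Aᵢ-indep , v-fresh = free-vertex (proj₁ A-packing) i (≰⇒> r≰∣Aᵢ∣)
            E = extend-at d (insertAt-DisjointIndependent A-packing v∪Aᵢ-indep v-fresh) i (r≤d+∣A′ᵢ∣ v∉Aᵢ)
        in record
          { family   = family E
          ; packing  = packing E
          ; extends  = λ j → ⊆-trans (⊆-insertAt {i = i} j) (extends E j)
          ; complete = complete E
          }
        where
        open Extension
        r≤d+∣A′ᵢ∣ : ∀ {v} → v ∉ A i → r ≤ d + ∣ insertAt A i v i ∣
        r≤d+∣A′ᵢ∣ {v} v∉Aᵢ = begin
          r                                          ≤⟨ r≤1+d+∣Aᵢ∣ ⟩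
          suc d + ∣ A i ∣                            ≡⟨ +-suc d _ ⟨
          d + suc ∣ A i ∣                            ≡⟨ cong (d +_) (∣⁅x⁆∪p∣≡1+∣p∣ v∉Aᵢ) ⟨
          d + ∣ ⁅ v ⁆ ∪ A i ∣                         ≡⟨ cong (λ T → d + ∣ T ∣) (updateAt-updates i A) ⟨
          d + ∣ insertAt A i v i ∣   ∎
          where open ≤-Reasoning

      extend-all : ∀ (is : List (Fin (suc p))) {A : Fin (suc p) → Subset (n G)} → DisjointIndependent A →
                   Extension A (_∈ₗ is)
      extend-all []       {A} A-packing = record
        { family = A ; packing = A-packing ; extends = λ _ → ⊆-refl ; complete = λ _ () }
      extend-all (i ∷ₗ is) {A} A-packing = record
        { family   = family E₂
        ; packing  = packing E₂
        ; extends  = λ j → ⊆-trans (extends E₁ j) (extends E₂ j)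
        ; complete = λ where
            j (hereₗ refl)  → Maximum-⊆ (complete E₁ i refl) (extends E₂ i) (proj₁ (packing E₂) i)
            j (thereₗ j∈is) → complete E₂ j j∈is
        }
        where
        open Extension
        E₁ = extend-at r A-packing i (m≤m+n r _)
        E₂ = extend-all is (packing E₁)

      WellCovered∧FAtLeast⇒W : W (suc p) G
      WellCovered∧FAtLeast⇒W = 1+p≤n , λ A A-indep A-disj →
        let open Extension (extend-all (allFin _) (A-indep , A-disj))
        in family , (λ i → complete i (∈-allFin i)) , extends , proj₂ packing
        where
        1+p≤n : suc p ≤ n G
        1+p≤n = let S , S-indep , ∣S∣+1≡r = ∃-ridge
                    L , _ , p<∣L∣ = F-large S S-indep ∣S∣+1≡r
                in ≤-trans p<∣L∣ (∣p∣≤n L)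

    A⇔C : ∀ {p} → CondA (suc p) G ⇔ CondC (suc p) G r
    A⇔C = mk⇔
      (λ (critical , w) →
         W⇒WellCovered w , W⇒FAtLeast w , Equivalence.to AlphaCritical⇔EdgesInCommonF critical)
      (λ (well-covered , F-large , edges) →
         Equivalence.from AlphaCritical⇔EdgesInCommonF edges , WellCovered∧FAtLeast⇒W well-covered F-large)

    Pure⇔WellCovered : Pure (IndComplex G) ⇔ WellCovered G
    Pure⇔WellCovered = mk⇔
      (λ pure S S-maximal →
         let S′ , S′-maximal , ∣S′∣≡r = ∃-MaximalIndep
         in ∣∣≡r⇒Maximum (proj₁ S-maximal) (trans (pure S S′ S-maximal S′-maximal) ∣S′∣≡r))
      (λ well-covered F F′ F-maximal F′-maximal →
         trans (Maximum⇒∣∣≡r (well-covered F F-maximal)) (sym (Maximum⇒∣∣≡r (well-covered F′ F′-maximal))))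

    IsRidge⇔ : WellCovered G → ∀ {S} → IsRidge (IndComplex G) S ⇔ (Independent G S × suc ∣ S ∣ ≡ r)
    IsRidge⇔ well-covered = mk⇔
      (λ (S-indep , F , F-maximal , ∣S∣+1≡∣F∣) →
         S-indep , trans ∣S∣+1≡∣F∣ (Maximum⇒∣∣≡r (well-covered F F-maximal)))
      (λ (S-indep , ∣S∣+1≡r) → let S′ , S′-maximal , ∣S′∣≡r = ∃-MaximalIndep
                               in S-indep , S′ , S′-maximal , trans ∣S∣+1≡r (sym ∣S′∣≡r))

    LinkVertex⇔InF : ∀ {S v} → suc ∣ S ∣ ≡ r → LinkVertex (IndComplex G) S v ⇔ InF G S v
    LinkVertex⇔InF {v = v} ∣S∣+1≡r =
      ⇔-sym (InF⇔ ∣S∣+1≡r) ⇔-∘ mk⇔ proj₂ (λ extension → Independent-⁅⁆ v , extension)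

    ridge-degrees⇔FAtLeast : ∀ {p} → WellCovered G →
                             (∀ S → IsRidge (IndComplex G) S → DegreeAtLeast (IndComplex G) S p) ⇔ FAtLeast p
    ridge-degrees⇔FAtLeast well-covered = mk⇔
      (λ degrees S S-indep ∣S∣+1≡r →
         CountAtLeast-cong (λ _ → LinkVertex⇔InF ∣S∣+1≡r)
                           (degrees S (Equivalence.from (IsRidge⇔ well-covered) (S-indep , ∣S∣+1≡r))))
      (λ F-large S S-ridge →
         let S-indep , ∣S∣+1≡r = Equivalence.to (IsRidge⇔ well-covered) S-ridge
         in CountAtLeast-cong (λ _ → ⇔-sym (LinkVertex⇔InF ∣S∣+1≡r)) (F-large S S-indep ∣S∣+1≡r))

    MissingEdgesInLinks : Set
    MissingEdgesInLinks =
      ∀ x y → MissingEdge Δ x y → Σ _ λ R → IsRidge Δ R × LinkVertex Δ R x × LinkVertex Δ R y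
      where Δ = IndComplex G

    MissingEdgesInLinks⇔EdgesInCommonF : WellCovered G → MissingEdgesInLinks ⇔ EdgesInCommonF
    MissingEdgesInLinks⇔EdgesInCommonF well-covered = mk⇔ to from
      where
      to : MissingEdgesInLinks → EdgesInCommonF
      to missing-edges x y = mk⇔
        (λ xy≡true →
           let R , R-ridge , x∈lk , y∈lk = missing-edges x y (Equivalence.from MissingEdge⇔adj xy≡true)
               R-indep , ∣R∣+1≡r = Equivalence.to (IsRidge⇔ well-covered) R-ridge
           in R , R-indep , ∣R∣+1≡r , adj⇒≢ xy≡true ,
              Equivalence.to (LinkVertex⇔InF ∣R∣+1≡r) x∈lk , Equivalence.to (LinkVertex⇔InF ∣R∣+1≡r) y∈lk)
        InCommonF⇒adj
      from : EdgesInCommonF → MissingEdgesInLinks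
      from edges x y xy-missing =
        let S , S-indep , ∣S∣+1≡r , _ , x∈F , y∈F =
              Equivalence.to (edges x y) (Equivalence.to MissingEdge⇔adj xy-missing)
        in S , Equivalence.from (IsRidge⇔ well-covered) (S-indep , ∣S∣+1≡r) ,
           Equivalence.from (LinkVertex⇔InF ∣S∣+1≡r) x∈F , Equivalence.from (LinkVertex⇔InF ∣S∣+1≡r) y∈F

    B⇔C : ∀ {p} → CondB p G ⇔ CondC p G r
    B⇔C = mk⇔
      (λ (pure , degrees , missing-edges) →
         let well-covered = Equivalence.to Pure⇔WellCovered pure
         in well-covered , Equivalence.to (ridge-degrees⇔FAtLeast well-covered) degrees ,
            Equivalence.to (MissingEdgesInLinks⇔EdgesInCommonF well-covered) missing-edges)
      (λ (well-covered , F-large , edges) →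
         Equivalence.from Pure⇔WellCovered well-covered ,
         Equivalence.from (ridge-degrees⇔FAtLeast well-covered) F-large ,
         Equivalence.from (MissingEdgesInLinks⇔EdgesInCommonF well-covered) edges)

    Saturated⇔AlphaCritical : Saturated (H) (suc r) ⇔ AlphaCritical G
    Saturated⇔AlphaCritical = mk⇔ to from
      where
      Clique⇔IndepR : ∀ {x y Q} → Clique (addEdge H x y) Q ⇔ IndepR (deleteEdge (adj G) x y) Q
      Clique⇔IndepR = Clique-addEdge-complement⇔IndepR-deleteEdge (adj-irrefl G)
      to : Saturated (H) (suc r) → AlphaCritical G
      to (_ , saturating) x y xy≡true =
        let x≢y = adj⇒≢ xy≡true
            Q , Q-clique , ∣Q∣≡1+r =
              saturating x y x≢y (Equivalence.from (complementAdj≡false⇔adj x≢y) xy≡true)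
        in Equivalence.from AlphaCriticalEdge⇔ (Q , Equivalence.to Clique⇔IndepR Q-clique , ∣Q∣≡1+r)
      from : AlphaCritical G → Saturated (H) (suc r)
      from critical = no-large-clique , λ x y x≢y co≡false →
        let T , T-indep , ∣T∣≡1+r = Equivalence.to AlphaCriticalEdge⇔
                                      (critical x y (Equivalence.to (complementAdj≡false⇔adj x≢y) co≡false))
        in T , Equivalence.from Clique⇔IndepR T-indep , ∣T∣≡1+r
        where
        no-large-clique : ∀ Q → Clique (H) Q → ∣ Q ∣ ≢ suc r
        no-large-clique Q Q-clique ∣Q∣≡1+r =
          n≮n r (subst (_≤ r) ∣Q∣≡1+r (∣indep∣≤r (Equivalence.to Clique⇔Independent Q-clique)))

    WellCovered⇔MaximalClique-∣∣≡r : WellCovered G ⇔ (∀ Q → MaximalClique (H) Q → ∣ Q ∣ ≡ r)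
    WellCovered⇔MaximalClique-∣∣≡r = mk⇔
      (λ well-covered Q Q-maximal →
         Maximum⇒∣∣≡r (well-covered Q (Equivalence.to MaximalClique⇔MaximalIndep Q-maximal)))
      (λ maximal-cliques S S-maximal →
         ∣∣≡r⇒Maximum (proj₁ S-maximal)
                      (maximal-cliques S (Equivalence.from MaximalClique⇔MaximalIndep S-maximal)))

    FAtLeast⇔codegrees : ∀ {p} → FAtLeast p ⇔
                         (∀ Q → Clique (H) Q → suc ∣ Q ∣ ≡ r → CodegAtLeast (H) Q p)
    FAtLeast⇔codegrees = mk⇔
      (λ F-large Q Q-clique ∣Q∣+1≡r →
         CountAtLeast-cong (λ _ → ⇔-sym (codegree-vertex⇔InF ∣Q∣+1≡r))
                           (F-large Q (Equivalence.to Clique⇔Independent Q-clique) ∣Q∣+1≡r))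
      (λ codegrees S S-indep ∣S∣+1≡r →
         CountAtLeast-cong (λ _ → codegree-vertex⇔InF ∣S∣+1≡r)
                           (codegrees S (Equivalence.from Clique⇔Independent S-indep) ∣S∣+1≡r))
      where
      codegree-vertex⇔InF : ∀ {Q x} → suc ∣ Q ∣ ≡ r →
                            (x ∉ Q × Clique (H) (⁅ x ⁆ ∪ Q)) ⇔ InF G Q x
      codegree-vertex⇔InF ∣Q∣+1≡r = ⇔-sym (InF⇔ ∣Q∣+1≡r) ⇔-∘ (⇔-id _ ×-⇔ Clique⇔Independent)

    D⇔C : ∀ {p} → CondD p G r ⇔ CondC p G r
    D⇔C = mk⇔
      (λ (saturated , maximal-cliques , codegrees) →
         Equivalence.from WellCovered⇔MaximalClique-∣∣≡r maximal-cliques ,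
         Equivalence.from FAtLeast⇔codegrees codegrees ,
         Equivalence.to AlphaCritical⇔EdgesInCommonF (Equivalence.to Saturated⇔AlphaCritical saturated))
      (λ (well-covered , F-large , edges) →
         Equivalence.from Saturated⇔AlphaCritical (Equivalence.from AlphaCritical⇔EdgesInCommonF edges) ,
         Equivalence.to WellCovered⇔MaximalClique-∣∣≡r well-covered ,
         Equivalence.to FAtLeast⇔codegrees F-large)

theorem5p1 : (p : ℕ) → 1 ≤ p → (G : Graph) → (r : ℕ) → IsAlpha G r →
    (CondA p G ⇔ CondB p G) × (CondA p G ⇔ CondC p G r) × (CondA p G ⇔ CondD p G r)
theorem5p1 (suc p) _ G r α = ⇔-sym (B⇔C G α) ⇔-∘ A⇔C G α , A⇔C G α , ⇔-sym (D⇔C G α) ⇔-∘ A⇔C G α
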